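{- Let $n\ge2$ and let $\mathsf u$ be an $e$-subword of $\boldsymbol\lambda_n$. For every $1\le j\le n(n-1)$, write the reflection $t_j=u_{(j-1)}\,s_{j-1}\,u_{(j-1)}^{ -1}$ as $(\!(a,b)\!)$. Then $|b-a|\le n-1$.
   Context: $\widetilde S_n$ is the affine symmetric group (bijections $w:\mathbb Z\to\mathbb Z$ with $w(i+n)=w(i)+n$ and $\sum_{i=1}^n w(i)=\binom{n+1}{2}$, multiplied by composition $(vw)(k)=v(w(k))$). For $i\not\equiv j\pmod n$, $(\!(i,j)\!)$ interchanges $i+kn$ and $j+kn$ for all $k\in\mathbb Z$ and fixes other integers; the quantity $|b-a|$ does not depend on how a reflection is written as $(\!(a,b)\!)$. $s_j=(\!(j,j+1)\!)$. $\boldsymbol\lambda_n$ is the word $[s_0,\dots,s_{n-1}]$ repeated $n-1$ times; its $j$-th letter ($1\le j\le n(n-1)$) is $s_{j-1}$. A subword is $\mathsf u=[u_1,\dots,u_{n(n-1)}]$ with each $u_j$ either the $j$-th letter or $e$; $u_{(j)}=u_1\cdots u_j$ with $u_{(0)}=e$; $\mathsf u$ is an $e$-subword if $u_{(n(n-1))}=e$. -}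

module Defs where

open import Data.Nat as ℕ using (ℕ; zero; suc)
open import Data.Nat.Divisibility using (_∣_; _∣?_)
open import Data.Integer using (ℤ; +_; _+_; _-_; ∣_∣)
open import Data.Bool using (Bool; true; false)
open import Data.List using (List; []; _∷_; take)
open import Relation.Nullary using (yes; no)
open import Function using (id; _∘_)

_≡_[mod_] : ℤ → ℤ → ℕ → Set
a ≡ b [mod n ] = n ∣ ∣ a - b ∣

-- The affine reflection ((a,b)) of S̃_n, as a map ℤ → ℤ:
-- it interchanges a + kn and b + kn for all k and fixes other integers.
-- (Meaningful for a ≢ b mod n.)
refl⟨_⟩ : ℕ → ℤ → ℤ → ℤ → ℤ
refl⟨ n ⟩ a b k with n ∣? ∣ k - a ∣
... | yes _ = k + (b - a)
... | no _ with n ∣? ∣ k - b ∣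
...   | yes _ = k - (b - a)
...   | no _ = k

s⟨_⟩ : ℕ → ℕ → ℤ → ℤ
s⟨ n ⟩ j = refl⟨ n ⟩ (+ j) (+ suc j)

len : ℕ → ℕ
len n = n ℕ.* (n ℕ.∸ 1)

-- A subword of λ_n is encoded by a list of booleans of length n(n-1):
-- entry at (0-based) position p is true iff u_{p+1} is the letter s_p
-- (the (p+1)-th letter of λ_n is s_p = s_{p mod n}), false iff u_{p+1} = e.
-- prodFrom n p bs = product (composition, leftmost factor applied last)
-- of the letters chosen by bs, starting at 0-based position p.
prodFrom : ℕ → ℕ → List Bool → ℤ → ℤ
prodFrom n p [] = id
prodFrom n p (true ∷ bs) = s⟨ n ⟩ p ∘ prodFrom n (suc p) bs
prodFrom n p (false ∷ bs) = prodFrom n (suc p) bs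

prefix : ℕ → List Bool → ℕ → ℤ → ℤ
prefix n u j = prodFrom n 0 (take j u)

module Submission where

open import Defs
open import Data.Nat using (ℕ; _≤_; _∸_)
open import Data.Integer using (ℤ; _-_; ∣_∣)
open import Data.Bool using (Bool)
open import Data.List using (List; length)
open import Relation.Binary.PropositionalEquality using (_≡_)
open import Relation.Nullary using (¬_)

open import Data.Bool using (true; false)
open import Data.List using ([]; _∷_; _++_; take; drop)
import Data.List.Properties as List
open import Data.Nat as ℕ using (zero; suc; s≤s; _<_; NonZero)
import Data.Nat.Properties as ℕ
open import Data.Nat.Divisibility using (_∣_; _∣?_; ∣-refl; _∣0; ∣1⇒≡1)
open import Data.Integer using (+_; -[1+_]; _+_; _*_; -_; 0ℤ; 1ℤ; -1ℤ; _/ℕ_; +<+; +≤+)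
  renaming (suc to sucℤ)
import Data.Integer.Base as ℤ
import Data.Integer.Properties as ℤ
open import Data.Integer.DivMod using (a≡a%ℕn+[a/ℕn]*n; n%ℕd<d)
open import Data.Integer.Divisibility.Signed using (∣ᵤ⇒∣; divides)
open import Data.Integer.Tactic.RingSolver using (solve-∀)
open import Data.Product using (∃-syntax; _,_)
open import Data.Sum using (_⊎_; inj₁; inj₂)
open import Function using (_∘_)
open import Relation.Binary.PropositionalEquality
  using (refl; sym; trans; cong; subst; subst₂; _≢_; module ≡-Reasoning)
open import Relation.Binary.Definitions using (tri<; tri≈; tri>)
open import Relation.Nullary using (yes; no; contradiction)

-- Let F = u_(p) with p = j - 1, so that t_j = ((F p, F (p+1))).  With
-- ψ x = x - ⌊x/n⌋, the potential Φ t z = t + ψ (z - t) satisfies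
-- Φ t (x z) ≤ Φ (t+1) z for x ∈ {e, s_t}, and so does Φ (t+1).  Telescoping
-- over the first p letters of u (whose product is F) and over the remaining
-- ones (whose product is F⁻¹, as u is an e-subword) gives
--   ψ (F p) ≤ p,   ψ (F (p+1) - 1) ≤ p,   p < ψ (F p + n),   p < ψ (F (p+1) + n),
-- because Φ (n(n-1)) z = ψ (z + n).  As ψ is monotone, F p < F (p+1) + n and
-- F (p+1) - 1 < F p + n, so |F (p+1) - F p| ≤ n, and equality is excluded
-- because t_j is a reflection.

module _ (n : ℕ) .{{_ : NonZero n}} where

  private
    division : ∀ i → i ≡ + (i ℤ.%ℕ n) + i /ℕ n * + n
    division i = a≡a%ℕn+[a/ℕn]*n i n

    quotient-mono : ∀ {r r′ q q′} → r < n → q ℤ.< q′ → + r + q * + n ℤ.< + r′ + q′ * + n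
    quotient-mono {r} {r′} {q} {q′} r<n q<q′ = begin-strict
      + r + q * + n    <⟨ ℤ.+-monoˡ-< (q * + n) (+<+ r<n) ⟩
      + n + q * + n    ≡⟨ ℤ.suc-* q (+ n) ⟨
      sucℤ q * + n     ≤⟨ ℤ.*-monoʳ-≤-nonNeg (+ n) (ℤ.i<j⇒suc[i]≤j q<q′) ⟩
      q′ * + n         ≤⟨ ℤ.i≤j+i (q′ * + n) (+ r′) ⟩
      + r′ + q′ * + n  ∎
      where open ℤ.≤-Reasoning

    quotient-injective : ∀ {r r′ q q′} → r < n → r′ < n →
                         + r + q * + n ≡ + r′ + q′ * + n → q ≡ q′
    quotient-injective {q = q} {q′} r<n r′<n eq with ℤ.<-cmp q q′
    ... | tri< q<q′ _ _ = contradiction eq (ℤ.<⇒≢ (quotient-mono r<n q<q′))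
    ... | tri≈ _ q≡q′ _ = q≡q′
    ... | tri> _ _ q>q′ = contradiction (sym eq) (ℤ.<⇒≢ (quotient-mono r′<n q>q′))

  /ℕ-unique : ∀ {r} q → r < n → (+ r + q * + n) /ℕ n ≡ q
  /ℕ-unique {r} q r<n = sym (quotient-injective r<n (n%ℕd<d i n) (division i))
    where i = + r + q * + n

  /ℕ-mono-≤ : ∀ {i j} → i ℤ.≤ j → i /ℕ n ℤ.≤ j /ℕ n
  /ℕ-mono-≤ {i} {j} i≤j = ℤ.≮⇒≥ λ j/n<i/n → ℤ.<⇒≱
    (subst₂ ℤ._<_ (sym (division j)) (sym (division i)) (quotient-mono (n%ℕd<d j n) j/n<i/n))
    i≤j

  [i+k*n]/ℕn≡i/ℕn+k : ∀ i k → (i + k * + n) /ℕ n ≡ i /ℕ n + k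
  [i+k*n]/ℕn≡i/ℕn+k i k = begin
    (i + k * + n) /ℕ n                ≡⟨ cong (λ j → (j + k * + n) /ℕ n) (division i) ⟩
    (+ r + q * + n + k * + n) /ℕ n    ≡⟨ cong (_/ℕ n) (ℤ.+-assoc (+ r) (q * + n) (k * + n)) ⟩
    (+ r + (q * + n + k * + n)) /ℕ n  ≡⟨ cong (λ j → (+ r + j) /ℕ n) (ℤ.*-distribʳ-+ (+ n) q k) ⟨
    (+ r + (q + k) * + n) /ℕ n        ≡⟨ /ℕ-unique (q + k) (n%ℕd<d i n) ⟩
    q + k                             ∎
    where
      open ≡-Reasoning
      r = i ℤ.%ℕ n
      q = i /ℕ n

  [i+1]/ℕn≤i/ℕn+1 : ∀ i → (i + 1ℤ) /ℕ n ℤ.≤ i /ℕ n + 1ℤ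
  [i+1]/ℕn≤i/ℕn+1 i = begin
    (i + 1ℤ) /ℕ n        ≤⟨ /ℕ-mono-≤ (ℤ.+-monoʳ-≤ i (+≤+ (ℕ.>-nonZero⁻¹ n))) ⟩
    (i + + n) /ℕ n       ≡⟨ cong (λ c → (i + c) /ℕ n) (ℤ.*-identityˡ (+ n)) ⟨
    (i + 1ℤ * + n) /ℕ n  ≡⟨ [i+k*n]/ℕn≡i/ℕn+k i 1ℤ ⟩
    i /ℕ n + 1ℤ          ∎
    where open ℤ.≤-Reasoning

private
  [1+i]-i≡1 : ∀ i → (1ℤ + i) - i ≡ 1ℤ
  [1+i]-i≡1 = solve-∀

  [i+j]-i≡j : ∀ i j → (i + j) - i ≡ j
  [i+j]-i≡j = solve-∀

  [i-j]-i≡-j : ∀ i j → (i - j) - i ≡ - j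
  [i-j]-i≡-j = solve-∀

∣i∣<n : ∀ {n} i → - + n ℤ.< i → i ℤ.≤ + n → ¬ n ∣ ∣ i ∣ → ∣ i ∣ < n
∣i∣<n (+ d) _ (+≤+ d≤n) n∤d = ℕ.≤∧≢⇒< d≤n (λ d≡n → n∤d (subst (_ ∣_) (sym d≡n) ∣-refl))
∣i∣<n {suc n} -[1+ d ] (ℤ.-<- d<n) _ _ = s≤s d<n

∣j-i∣<n : ∀ {n} i j → i ℤ.< j + + n → j - 1ℤ ℤ.< i + + n → ¬ n ∣ ∣ j - i ∣ → ∣ j - i ∣ < n
∣j-i∣<n {n} i j i<j+n j-1<i+n = ∣i∣<n (j - i) -n<j-i j-i≤n
  where
    -n<j-i : - + n ℤ.< j - i
    -n<j-i = subst₂ ℤ._<_ (regroup₁ j (+ n)) (regroup₂ i j)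
                    (ℤ.neg-mono-< (ℤ.+-monoˡ-< (- j) i<j+n))
      where
        regroup₁ : ∀ j n → - (j + n - j) ≡ - n
        regroup₁ = solve-∀
        regroup₂ : ∀ i j → - (i - j) ≡ j - i
        regroup₂ = solve-∀
    j-i≤n : j - i ℤ.≤ + n
    j-i≤n = subst₂ ℤ._≤_ (regroup₁ i j) (regroup₂ i (+ n))
                   (ℤ.i<j⇒suc[i]≤j (ℤ.+-monoˡ-< (- i) j-1<i+n))
      where
        regroup₁ : ∀ i j → 1ℤ + (j - 1ℤ - i) ≡ j - i
        regroup₁ = solve-∀
        regroup₂ : ∀ i n → i + n - i ≡ n
        regroup₂ = solve-∀

data S-View (n t : ℕ) (w : ℤ) : ℤ → Set where
  up   : n ∣ ∣ w - + t ∣ → S-View n t w (w + 1ℤ)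
  down : S-View n t w (w - 1ℤ)
  fix  : S-View n t w w

s-view : ∀ n t w → S-View n t w (s⟨ n ⟩ t w)
s-view n t w with n ∣? ∣ w - + t ∣
... | yes n∣w-t = subst (S-View n t w) (cong (_+_ w) (sym ([1+i]-i≡1 (+ t)))) (up n∣w-t)
... | no _ with n ∣? ∣ w - + suc t ∣
...   | yes _ = subst (S-View n t w) (cong (_-_ w) (sym ([1+i]-i≡1 (+ t)))) down
...   | no _  = fix

s[t]≡1+t : ∀ n t → s⟨ n ⟩ t (+ t) ≡ + suc t
s[t]≡1+t n t with n ∣? ∣ + t - + t ∣
... | yes _  = trans (cong (_+_ (+ t)) ([1+i]-i≡1 (+ t))) (ℤ.+-comm (+ t) 1ℤ)
... | no n∤0 = contradiction (subst (λ i → n ∣ ∣ i ∣) (sym (ℤ.+-inverseʳ (+ t))) (n ∣0)) n∤0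

refl-displacement : ∀ n a b x → refl⟨ n ⟩ a b x ≢ x → ∣ refl⟨ n ⟩ a b x - x ∣ ≡ ∣ b - a ∣
refl-displacement n a b x moved with n ∣? ∣ x - a ∣
... | yes _ = cong ∣_∣ ([i+j]-i≡j x (b - a))
... | no _ with n ∣? ∣ x - b ∣
...   | yes _ = trans (cong ∣_∣ ([i-j]-i≡-j x (b - a))) (ℤ.∣-i∣≡∣i∣ (b - a))
...   | no _  = contradiction refl moved

prodFrom-++ : ∀ n t xs ys z →
              prodFrom n t (xs ++ ys) z ≡ prodFrom n t xs (prodFrom n (t ℕ.+ length xs) ys z)
prodFrom-++ n t []           ys z rewrite ℕ.+-identityʳ t = refl
prodFrom-++ n t (true ∷ xs)  ys z rewrite ℕ.+-suc t (length xs) =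
  cong (s⟨ n ⟩ t) (prodFrom-++ n (suc t) xs ys z)
prodFrom-++ n t (false ∷ xs) ys z rewrite ℕ.+-suc t (length xs) = prodFrom-++ n (suc t) xs ys z

record Potential (n : ℕ) (P : ℕ → ℤ → ℤ) : Set where
  field
    skip : ∀ t w → P t w ℤ.≤ P (suc t) w
    step : ∀ t w → P t (s⟨ n ⟩ t w) ℤ.≤ P (suc t) w

prodFrom-potential : ∀ {n P} → Potential n P →
                     ∀ t bs z → P t (prodFrom n t bs z) ℤ.≤ P (t ℕ.+ length bs) z
prodFrom-potential {n} {P} pot t []       z rewrite ℕ.+-identityʳ t = ℤ.≤-refl
prodFrom-potential {n} {P} pot t (b ∷ bs) z rewrite ℕ.+-suc t (length bs) =
  ℤ.≤-trans (first-letter b) (prodFrom-potential pot (suc t) bs z)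
  where
    open Potential pot
    first-letter : ∀ b → P t (prodFrom n t (b ∷ bs) z) ℤ.≤ P (suc t) (prodFrom n (suc t) bs z)
    first-letter true  = step t _
    first-letter false = skip t _

-- The split on m is only there to let the remainder computation reduce.
-2/ℕ[2+m]≡-1 : ∀ m → -[1+ 1 ] /ℕ (2 ℕ.+ m) ≡ -1ℤ
-2/ℕ[2+m]≡-1 zero    = refl
-2/ℕ[2+m]≡-1 (suc m) = refl

module _ (m : ℕ) where

  private
    n : ℕ
    n = 2 ℕ.+ m

  ψ : ℤ → ℤ
  ψ x = x - x /ℕ n

  ψ-+-* : ∀ x k → ψ (x + k * + n) ≡ ψ x + (k * + n - k)
  ψ-+-* x k = begin
    (x + k * + n) - (x + k * + n) /ℕ n  ≡⟨ cong (_-_ (x + k * + n)) ([i+k*n]/ℕn≡i/ℕn+k n x k) ⟩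
    (x + k * + n) - (x /ℕ n + k)        ≡⟨ regroup x (x /ℕ n) (k * + n) k ⟩
    ψ x + (k * + n - k)                 ∎
    where
      open ≡-Reasoning
      regroup : ∀ x q c k → (x + c) - (q + k) ≡ (x - q) + (c - k)
      regroup = solve-∀

  ψ-mono-suc : ∀ x → ψ x ℤ.≤ ψ (x + 1ℤ)
  ψ-mono-suc x = begin
    x - x /ℕ n                ≡⟨ regroup x (x /ℕ n) ⟩
    (x + 1ℤ) - (x /ℕ n + 1ℤ)  ≤⟨ ℤ.+-monoʳ-≤ (x + 1ℤ) (ℤ.neg-mono-≤ ([i+1]/ℕn≤i/ℕn+1 n x)) ⟩
    (x + 1ℤ) - (x + 1ℤ) /ℕ n  ∎
    where
      open ℤ.≤-Reasoning
      regroup : ∀ x q → x - q ≡ (x + 1ℤ) - (q + 1ℤ)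
      regroup = solve-∀

  ψ-suc-≤ : ∀ x → ψ (x + 1ℤ) ℤ.≤ ψ x + 1ℤ
  ψ-suc-≤ x = begin
    (x + 1ℤ) - (x + 1ℤ) /ℕ n  ≤⟨ ℤ.+-monoʳ-≤ (x + 1ℤ) (ℤ.neg-mono-≤ (/ℕ-mono-≤ n (ℤ.i≤i+j x 1ℤ))) ⟩
    (x + 1ℤ) - x /ℕ n         ≡⟨ regroup x (x /ℕ n) ⟩
    x - x /ℕ n + 1ℤ           ∎
    where
      open ℤ.≤-Reasoning
      regroup : ∀ x q → (x + 1ℤ) - q ≡ x - q + 1ℤ
      regroup = solve-∀

  ψ-mono-≤ : ∀ {x y} → x ℤ.≤ y → ψ x ℤ.≤ ψ y
  ψ-mono-≤ {x} {y} x≤y = subst (λ z → ψ x ℤ.≤ ψ z) x+[y-x]≡y (ψ-mono-+ ∣ y - x ∣)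
    where
      open ℤ.≤-Reasoning
      ψ-mono-+ : ∀ k → ψ x ℤ.≤ ψ (x + + k)
      ψ-mono-+ zero    = ℤ.≤-reflexive (cong ψ (sym (ℤ.+-identityʳ x)))
      ψ-mono-+ (suc k) = begin
        ψ x                 ≤⟨ ψ-mono-+ k ⟩
        ψ (x + + k)         ≤⟨ ψ-mono-suc (x + + k) ⟩
        ψ (x + + k + 1ℤ)    ≡⟨ cong ψ (ℤ.+-assoc x (+ k) 1ℤ) ⟩
        ψ (x + (+ k + 1ℤ))  ≡⟨ cong (λ c → ψ (x + c)) (ℤ.+-comm (+ k) 1ℤ) ⟩
        ψ (x + + suc k)     ∎
      x+[y-x]≡y : x + + ∣ y - x ∣ ≡ y
      x+[y-x]≡y = trans (cong (_+_ x) (ℤ.0≤i⇒+∣i∣≡i (ℤ.i≤j⇒0≤j-i x≤y))) (i+[j-i]≡j x y)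
        where
          i+[j-i]≡j : ∀ i j → i + (j - i) ≡ j
          i+[j-i]≡j = solve-∀

  ψ-reflects-< : ∀ {x y} → ψ x ℤ.< ψ y → x ℤ.< y
  ψ-reflects-< ψx<ψy = ℤ.≰⇒> (λ y≤x → ℤ.<⇒≱ ψx<ψy (ψ-mono-≤ y≤x))

  Φ : ℤ → ℤ → ℤ
  Φ t z = t + ψ (z - t)

  Φ-skip : ∀ t w → Φ t w ℤ.≤ Φ (1ℤ + t) w
  Φ-skip t w = begin
    t + ψ (w - t)                ≡⟨ cong (λ y → t + ψ y) (regroup₁ w t) ⟩
    t + ψ (w - (1ℤ + t) + 1ℤ)    ≤⟨ ℤ.+-monoʳ-≤ t (ψ-suc-≤ (w - (1ℤ + t))) ⟩
    t + (ψ (w - (1ℤ + t)) + 1ℤ)  ≡⟨ regroup₂ t (ψ (w - (1ℤ + t))) ⟩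
    1ℤ + t + ψ (w - (1ℤ + t))    ∎
    where
      open ℤ.≤-Reasoning
      regroup₁ : ∀ w t → w - t ≡ w - (1ℤ + t) + 1ℤ
      regroup₁ = solve-∀
      regroup₂ : ∀ t y → t + (y + 1ℤ) ≡ 1ℤ + t + y
      regroup₂ = solve-∀

  Φ-pred : ∀ t w → Φ t (w - 1ℤ) ℤ.≤ Φ (1ℤ + t) w
  Φ-pred t w = begin
    t + ψ (w - 1ℤ - t)           ≡⟨ cong (λ y → t + ψ y) (regroup w t) ⟩
    t + ψ (w - (1ℤ + t))         ≤⟨ ℤ.i≤j+i _ 1ℤ ⟩
    1ℤ + (t + ψ (w - (1ℤ + t)))  ≡⟨ ℤ.+-assoc 1ℤ t _ ⟨
    1ℤ + t + ψ (w - (1ℤ + t))    ∎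
    where
      open ℤ.≤-Reasoning
      regroup : ∀ w t → w - 1ℤ - t ≡ w - (1ℤ + t)
      regroup = solve-∀

  Φ-+-* : ∀ t z k → Φ t (z + k * + n) ≡ Φ t z + (k * + n - k)
  Φ-+-* t z k = begin
    t + ψ (z + k * + n - t)          ≡⟨ cong (λ y → t + ψ y) (regroup z (k * + n) t) ⟩
    t + ψ (z - t + k * + n)          ≡⟨ cong (_+_ t) (ψ-+-* (z - t) k) ⟩
    t + (ψ (z - t) + (k * + n - k))  ≡⟨ ℤ.+-assoc t _ _ ⟨
    Φ t z + (k * + n - k)            ∎
    where
      open ≡-Reasoning
      regroup : ∀ z c t → z + c - t ≡ z - t + c
      regroup = solve-∀

  Φ-at : ∀ t z {d} → z - t ≡ d → Φ t z ≡ t + ψ d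
  Φ-at t z z-t≡d = cong (λ y → t + ψ y) z-t≡d

  -- ψ 0ℤ, ψ 1ℤ and ψ -1ℤ reduce to 0ℤ, 1ℤ and 0ℤ by evaluation; the next lemmas use this silently.

  Φ-zero : ∀ z → Φ 0ℤ z ≡ ψ z
  Φ-zero z = trans (ℤ.+-identityˡ _) (cong ψ (ℤ.+-identityʳ z))

  Φ-diag : ∀ t → Φ t t ≡ t
  Φ-diag t = trans (Φ-at t t (ℤ.+-inverseʳ t)) (ℤ.+-identityʳ t)

  Φ-above : ∀ t → Φ t (1ℤ + t) ≡ 1ℤ + t
  Φ-above t = trans (Φ-at t (1ℤ + t) ([1+i]-i≡1 t)) (ℤ.+-comm t 1ℤ)

  Φ-below : ∀ t → Φ (1ℤ + t) t ≡ 1ℤ + t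
  Φ-below t = trans (Φ-at (1ℤ + t) t (i-[1+i]≡-1 t)) (ℤ.+-identityʳ (1ℤ + t))
    where
      i-[1+i]≡-1 : ∀ i → i - (1ℤ + i) ≡ -1ℤ
      i-[1+i]≡-1 = solve-∀

  Φ-below₂ : ∀ t → Φ (1ℤ + (1ℤ + t)) t ≡ 1ℤ + t
  Φ-below₂ t = begin
    Φ (1ℤ + (1ℤ + t)) t          ≡⟨ Φ-at (1ℤ + (1ℤ + t)) t (i-[2+i]≡-2 t) ⟩
    1ℤ + (1ℤ + t) + ψ -[1+ 1 ]   ≡⟨ cong (λ q → 1ℤ + (1ℤ + t) + (-[1+ 1 ] - q)) (-2/ℕ[2+m]≡-1 m) ⟩
    1ℤ + (1ℤ + t) + -1ℤ          ≡⟨ regroup t ⟩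
    1ℤ + t                       ∎
    where
      open ≡-Reasoning
      i-[2+i]≡-2 : ∀ i → i - (1ℤ + (1ℤ + i)) ≡ -[1+ 1 ]
      i-[2+i]≡-2 = solve-∀
      regroup : ∀ t → 1ℤ + (1ℤ + t) + -1ℤ ≡ 1ℤ + t
      regroup = solve-∀

  private
    n∣i-j⇒i≡j+k*n : ∀ i j → n ∣ ∣ i - j ∣ → ∃[ k ] i ≡ j + k * + n
    n∣i-j⇒i≡j+k*n i j n∣i-j with ∣ᵤ⇒∣ {+ n} {i - j} n∣i-j
    ... | divides k i-j≡k*n = k , trans (i≡j+[i-j] i j) (cong (_+_ j) i-j≡k*n)
      where
        i≡j+[i-j] : ∀ i j → i ≡ j + (i - j)
        i≡j+[i-j] = solve-∀

    [t+c]+1≡[1+t]+c : ∀ t c → t + c + 1ℤ ≡ 1ℤ + t + c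
    [t+c]+1≡[1+t]+c = solve-∀

  Φ-up : ∀ t w → n ∣ ∣ w - t ∣ → Φ t (w + 1ℤ) ≡ Φ (1ℤ + t) w
  Φ-up t w n∣w-t with n∣i-j⇒i≡j+k*n w t n∣w-t
  ... | k , refl = begin
    Φ t (t + k * + n + 1ℤ)        ≡⟨ cong (Φ t) ([t+c]+1≡[1+t]+c t (k * + n)) ⟩
    Φ t (1ℤ + t + k * + n)        ≡⟨ Φ-+-* t (1ℤ + t) k ⟩
    Φ t (1ℤ + t) + (k * + n - k)  ≡⟨ cong (_+ (k * + n - k)) (trans (Φ-above t) (sym (Φ-below t))) ⟩
    Φ (1ℤ + t) t + (k * + n - k)  ≡⟨ Φ-+-* (1ℤ + t) t k ⟨
    Φ (1ℤ + t) (t + k * + n)      ∎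
    where open ≡-Reasoning

  Φ-up-suc : ∀ t w → n ∣ ∣ w - t ∣ → Φ (1ℤ + t) (w + 1ℤ) ≡ Φ (1ℤ + (1ℤ + t)) w
  Φ-up-suc t w n∣w-t with n∣i-j⇒i≡j+k*n w t n∣w-t
  ... | k , refl = begin
    Φ (1ℤ + t) (t + k * + n + 1ℤ)        ≡⟨ cong (Φ (1ℤ + t)) ([t+c]+1≡[1+t]+c t (k * + n)) ⟩
    Φ (1ℤ + t) (1ℤ + t + k * + n)        ≡⟨ Φ-+-* (1ℤ + t) (1ℤ + t) k ⟩
    Φ (1ℤ + t) (1ℤ + t) + (k * + n - k)
      ≡⟨ cong (_+ (k * + n - k)) (trans (Φ-diag (1ℤ + t)) (sym (Φ-below₂ t))) ⟩
    Φ (1ℤ + (1ℤ + t)) t + (k * + n - k)  ≡⟨ Φ-+-* (1ℤ + (1ℤ + t)) t k ⟨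
    Φ (1ℤ + (1ℤ + t)) (t + k * + n)      ∎
    where open ≡-Reasoning

  Φ-potential : Potential n (λ t → Φ (+ t))
  Φ-potential = record { skip = λ t → Φ-skip (+ t) ; step = step }
    where
      step : ∀ t w → Φ (+ t) (s⟨ n ⟩ t w) ℤ.≤ Φ (+ suc t) w
      step t w with s⟨ n ⟩ t w | s-view n t w
      ... | _ | up n∣w-t = ℤ.≤-reflexive (Φ-up (+ t) w n∣w-t)
      ... | _ | down     = Φ-pred (+ t) w
      ... | _ | fix      = Φ-skip (+ t) w

  Φ-suc-potential : Potential n (λ t → Φ (+ suc t))
  Φ-suc-potential = record { skip = λ t → Φ-skip (+ suc t) ; step = step }
    where
      step : ∀ t w → Φ (+ suc t) (s⟨ n ⟩ t w) ℤ.≤ Φ (+ suc (suc t)) w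
      step t w with s⟨ n ⟩ t w | s-view n t w
      ... | _ | up n∣w-t = ℤ.≤-reflexive (Φ-up-suc (+ t) w n∣w-t)
      ... | _ | down     = Φ-pred (+ suc t) w
      ... | _ | fix      = Φ-skip (+ suc t) w

  Φ-len : ∀ z → Φ (+ len n) z ≡ ψ (z + + n)
  Φ-len z = begin
    + len n + ψ (z - + len n)                  ≡⟨ cong (λ L → L + ψ (z - L)) len≡n*n-n ⟩
    N + ψ (z - N)                              ≡⟨ cong (λ y → N + ψ y) (regroup₁ z (+ n)) ⟩
    N + ψ (z + + n + - + n * + n)              ≡⟨ cong (_+_ N) (ψ-+-* (z + + n) (- + n)) ⟩
    N + (ψ (z + + n) + (- + n * + n - - + n))  ≡⟨ regroup₂ (+ n) (ψ (z + + n)) ⟩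
    ψ (z + + n)                                ∎
    where
      open ≡-Reasoning
      N = + n * + n - + n
      [1+s]*s≡[1+s]²-[1+s] : ∀ s → (1ℤ + s) * s ≡ (1ℤ + s) * (1ℤ + s) - (1ℤ + s)
      [1+s]*s≡[1+s]²-[1+s] = solve-∀
      len≡n*n-n : + len n ≡ N
      len≡n*n-n = trans (ℤ.pos-* n (suc m)) ([1+s]*s≡[1+s]²-[1+s] (+ suc m))
      regroup₁ : ∀ z n → z - (n * n - n) ≡ z + n + - n * n
      regroup₁ = solve-∀
      regroup₂ : ∀ n y → (n * n - n) + (y + (- n * n - - n)) ≡ y
      regroup₂ = solve-∀

  s[w]≡t⇒w≡1+t⊎w≡t : ∀ t w → s⟨ n ⟩ t w ≡ + t → w ≡ + suc t ⊎ w ≡ + t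
  s[w]≡t⇒w≡1+t⊎w≡t t w with s⟨ n ⟩ t w | s-view n t w
  ... | _ | up n∣w-t = λ w+1≡t →
    contradiction (∣1⇒≡1 (subst (λ i → n ∣ ∣ i ∣) (w-t≡-1 w+1≡t) n∣w-t)) λ ()
    where
      i-[i+1]≡-1 : ∀ i → i - (i + 1ℤ) ≡ -1ℤ
      i-[i+1]≡-1 = solve-∀
      w-t≡-1 : w + 1ℤ ≡ + t → w - + t ≡ -1ℤ
      w-t≡-1 w+1≡t = trans (cong (_-_ w) (sym w+1≡t)) (i-[i+1]≡-1 w)
  ... | _ | down = λ w-1≡t → inj₁ (trans (i≡1+[i-1] w) (cong (_+_ 1ℤ) w-1≡t))
    where
      i≡1+[i-1] : ∀ i → i ≡ 1ℤ + (i - 1ℤ)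
      i≡1+[i-1] = solve-∀
  ... | _ | fix = inj₂

  -- Telescoping from position t would only give t ≤ Φ; starting after the first
  -- letter gives t + 1, because that letter sends only t or t + 1 to t.
  1+t≤Φ : ∀ t bs z → 0 < length bs → prodFrom n t bs z ≡ + t →
          + suc t ℤ.≤ Φ (+ (t ℕ.+ length bs)) z
  1+t≤Φ t (b ∷ bs) z _ returns = begin
    + suc t                                ≡⟨ first-letter b returns ⟨
    Φ (+ suc t) (prodFrom n (suc t) bs z)  ≤⟨ prodFrom-potential Φ-potential (suc t) bs z ⟩
    Φ (+ (suc t ℕ.+ length bs)) z          ≡⟨ cong (λ k → Φ (+ k) z) (ℕ.+-suc t (length bs)) ⟨
    Φ (+ (t ℕ.+ suc (length bs))) z        ∎
    where
      open ℤ.≤-Reasoning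
      near-t : ∀ w → w ≡ + suc t ⊎ w ≡ + t → Φ (+ suc t) w ≡ + suc t
      near-t _ (inj₁ refl) = Φ-diag (+ suc t)
      near-t _ (inj₂ refl) = Φ-below (+ t)
      first-letter : ∀ b → prodFrom n t (b ∷ bs) z ≡ + t →
                     Φ (+ suc t) (prodFrom n (suc t) bs z) ≡ + suc t
      first-letter true  hits = near-t _ (s[w]≡t⇒w≡1+t⊎w≡t t (prodFrom n (suc t) bs z) hits)
      first-letter false hits = near-t _ (inj₂ hits)

  module ESubword (u : List Bool) (u-length : length u ≡ len n)
                  (e-subword : ∀ z → prefix n u (len n) z ≡ z)
                  (p : ℕ) (p<len : p < len n)
                  (v : ℤ → ℤ) (v-prefix : ∀ z → v (prefix n u p z) ≡ z) where

    A B : ℤ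
    A = prefix n u p (+ p)
    B = prefix n u p (+ suc p)

    private
      suffix : ℤ → ℤ
      suffix = prodFrom n p (drop p u)

      p<length-u : p < length u
      p<length-u = subst (p <_) (sym u-length) p<len

      length-take : length (take p u) ≡ p
      length-take = trans (List.length-take p u) (ℕ.m≤n⇒m⊓n≡m (ℕ.<⇒≤ p<length-u))

      p+length-drop : p ℕ.+ length (drop p u) ≡ len n
      p+length-drop = trans (cong (p ℕ.+_) (List.length-drop p u))
                            (trans (ℕ.m+[n∸m]≡n (ℕ.<⇒≤ p<length-u)) u-length)

      0<length-drop : 0 < length (drop p u)
      0<length-drop = subst (0 <_) (sym (List.length-drop p u)) (ℕ.m<n⇒0<n∸m p<length-u)

      prefix∘suffix : ∀ z → prefix n u p (suffix z) ≡ z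
      prefix∘suffix z = begin
        prodFrom n 0 (take p u) (prodFrom n p (drop p u) z)
          ≡⟨ cong (λ t → prodFrom n 0 (take p u) (prodFrom n t (drop p u) z)) length-take ⟨
        prodFrom n 0 (take p u) (prodFrom n (length (take p u)) (drop p u) z)
          ≡⟨ prodFrom-++ n 0 (take p u) (drop p u) z ⟨
        prodFrom n 0 (take p u ++ drop p u) z
          ≡⟨ cong (λ w → prodFrom n 0 w z) (List.take++drop≡id p u) ⟩
        prodFrom n 0 u z
          ≡⟨ cong (λ w → prodFrom n 0 w z) (List.take-all (len n) u (ℕ.≤-reflexive u-length)) ⟨
        prefix n u (len n) z
          ≡⟨ e-subword z ⟩
        z ∎
        where open ≡-Reasoning

      suffix∘prefix : ∀ z → suffix (prefix n u p z) ≡ z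
      suffix∘prefix z = begin
        suffix (prefix n u p z)                     ≡⟨ v-prefix (suffix (prefix n u p z)) ⟨
        v (prefix n u p (suffix (prefix n u p z)))  ≡⟨ cong v (prefix∘suffix (prefix n u p z)) ⟩
        v (prefix n u p z)                          ≡⟨ v-prefix z ⟩
        z                                           ∎
        where open ≡-Reasoning

      ψA≤p : ψ A ℤ.≤ + p
      ψA≤p = begin
        ψ A                            ≡⟨ Φ-zero A ⟨
        Φ 0ℤ A                         ≤⟨ prodFrom-potential Φ-potential 0 (take p u) (+ p) ⟩
        Φ (+ length (take p u)) (+ p)  ≡⟨ cong (λ k → Φ (+ k) (+ p)) length-take ⟩
        Φ (+ p) (+ p)                  ≡⟨ Φ-diag (+ p) ⟩
        + p                            ∎
        where open ℤ.≤-Reasoning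

      1+ψ[B-1]≤1+p : 1ℤ + ψ (B - 1ℤ) ℤ.≤ + suc p
      1+ψ[B-1]≤1+p = begin
        Φ 1ℤ B
          ≤⟨ prodFrom-potential Φ-suc-potential 0 (take p u) (+ suc p) ⟩
        Φ (+ suc (length (take p u))) (+ suc p)  ≡⟨ cong (λ k → Φ (+ suc k) (+ suc p)) length-take ⟩
        Φ (+ suc p) (+ suc p)                    ≡⟨ Φ-diag (+ suc p) ⟩
        + suc p                                  ∎
        where open ℤ.≤-Reasoning

      1+p≤ψ[B+n] : + suc p ℤ.≤ ψ (B + + n)
      1+p≤ψ[B+n] = begin
        + suc p                            ≡⟨ Φ-above (+ p) ⟨
        Φ (+ p) (+ suc p)                  ≡⟨ cong (Φ (+ p)) (suffix∘prefix (+ suc p)) ⟨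
        Φ (+ p) (suffix B)                 ≤⟨ prodFrom-potential Φ-potential p (drop p u) B ⟩
        Φ (+ (p ℕ.+ length (drop p u))) B  ≡⟨ cong (λ k → Φ (+ k) B) p+length-drop ⟩
        Φ (+ len n) B                      ≡⟨ Φ-len B ⟩
        ψ (B + + n)                        ∎
        where open ℤ.≤-Reasoning

      1+p≤ψ[A+n] : + suc p ℤ.≤ ψ (A + + n)
      1+p≤ψ[A+n] = begin
        + suc p                            ≤⟨ 1+t≤Φ p (drop p u) A 0<length-drop (suffix∘prefix (+ p)) ⟩
        Φ (+ (p ℕ.+ length (drop p u))) A  ≡⟨ cong (λ k → Φ (+ k) A) p+length-drop ⟩
        Φ (+ len n) A                      ≡⟨ Φ-len A ⟩
        ψ (A + + n)                        ∎
        where open ℤ.≤-Reasoning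

    A<B+n : A ℤ.< B + + n
    A<B+n = ψ-reflects-< (ℤ.suc[i]≤j⇒i<j (ℤ.≤-trans (ℤ.+-monoʳ-≤ 1ℤ ψA≤p) 1+p≤ψ[B+n]))

    B-1<A+n : B - 1ℤ ℤ.< A + + n
    B-1<A+n = ψ-reflects-< (ℤ.suc[i]≤j⇒i<j (ℤ.≤-trans 1+ψ[B-1]≤1+p 1+p≤ψ[A+n]))

lemma5p13 : (n : ℕ) → 2 ≤ n → (u : List Bool) → length u ≡ len n
            → (∀ k → prefix n u (len n) k ≡ k)
            → (j : ℕ) → 1 ≤ j → j ≤ len n
            → (v : ℤ → ℤ)
            → (∀ k → v (prefix n u (j ∸ 1) k) ≡ k)
            → (∀ k → prefix n u (j ∸ 1) (v k) ≡ k)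
            → (a b : ℤ) → ¬ (a ≡ b [mod n ])
            → (∀ k → prefix n u (j ∸ 1) (s⟨ n ⟩ (j ∸ 1) (v k)) ≡ refl⟨ n ⟩ a b k)
            → ∣ b - a ∣ ≤ n ∸ 1
lemma5p13 n@(suc (suc m)) _ u u-length e-subword (suc p) _ p<len v v-prefix _ a b a≢b t≡refl =
  ℕ.s≤s⁻¹ (subst (_< n) ∣B-A∣≡∣b-a∣ (∣j-i∣<n A B A<B+n B-1<A+n n∤B-A))
  where
    open ESubword m u u-length e-subword p p<len v v-prefix

    t[A]≡B : refl⟨ n ⟩ a b A ≡ B
    t[A]≡B = begin
      refl⟨ n ⟩ a b A                ≡⟨ t≡refl A ⟨
      prefix n u p (s⟨ n ⟩ p (v A))  ≡⟨ cong (prefix n u p ∘ s⟨ n ⟩ p) (v-prefix (+ p)) ⟩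
      prefix n u p (s⟨ n ⟩ p (+ p))  ≡⟨ cong (prefix n u p) (s[t]≡1+t n p) ⟩
      B                              ∎
      where open ≡-Reasoning

    B≢A : B ≢ A
    B≢A B≡A = ℕ.1+n≢n (ℤ.+-injective (begin
      + suc p  ≡⟨ v-prefix (+ suc p) ⟨
      v B      ≡⟨ cong v B≡A ⟩
      v A      ≡⟨ v-prefix (+ p) ⟩
      + p      ∎))
      where open ≡-Reasoning

    ∣B-A∣≡∣b-a∣ : ∣ B - A ∣ ≡ ∣ b - a ∣
    ∣B-A∣≡∣b-a∣ = subst (λ x → ∣ x - A ∣ ≡ ∣ b - a ∣) t[A]≡B
                    (refl-displacement n a b A (subst (_≢ A) (sym t[A]≡B) B≢A))

    n∤B-A : ¬ n ∣ ∣ B - A ∣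
    n∤B-A n∣B-A = a≢b (subst (n ∣_) (trans ∣B-A∣≡∣b-a∣ (ℤ.∣i-j∣≡∣j-i∣ b a)) n∣B-A)
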